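{- Let $\mathbb{H}$ be a hypergraph of order $n$ and let $h>k$ be nonnegative integers. Then $$\lambda_{h,k}(\mathbb{H})\le nh+\bar{\alpha}(\mathbb{H})(k-h)-k.$$
   Context: A hypergraph $\mathbb{H}=(V,E)$ consists of a finite vertex set $V$ and a family $E$ of subsets of $V$ (edges); all hypergraphs are simple: every edge has at least two elements and no edge contains another. A set $W\subseteq V$ is a strong stable set if $|W\cap e|\le1$ for every $e\in E$; the strong independence number $\bar{\alpha}(\mathbb{H})$ is the maximum cardinality of a strong stable set. For nonnegative integers $h>k$, an $L(h,k)$-colouring of $\mathbb{H}$ is a map $f:V\to\mathbb{Z}_{\ge0}$ such that $|f(u)-f(v)|\ge h$ whenever $u\neq v$ lie in a common edge, and $|f(u)-f(v)|\ge k$ whenever $u\ne v$ and there exist edges $e_1\ni v$, $e_2\ni u$ with $(e_1\cap e_2)\setminus\{u,v\}\neq\emptyset$. The span of $f$ is $\max f-\min f$; $\lambda_{h,k}(\mathbb{H})$ is the minimum span of an $L(h,k)$-colouring. -}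

module Defs where

open import Data.Nat using (ℕ; zero; suc; _≤_; _⊔_; _⊓_; _∸_; ∣_-_∣)
open import Data.Fin using (Fin; zero; suc)
open import Data.Fin.Subset using (Subset; _∈_; _⊆_; ∣_∣)
open import Data.Product using (Σ; ∃; _×_)
open import Relation.Nullary using (¬_)
open import Relation.Binary.PropositionalEquality using (_≡_; _≢_)

record Hypergraph (n : ℕ) : Set where
  field
    nE        : ℕ
    edge      : Fin nE → Subset n
    edge-size : ∀ i → 2 ≤ ∣ edge i ∣
    sperner   : ∀ i j → i ≢ j → ¬ (edge i ⊆ edge j)
open Hypergraph public

StrongStable : ∀ {n} → Hypergraph n → Subset n → Set
StrongStable H W = ∀ i u v → u ∈ W → v ∈ W → u ∈ edge H i → v ∈ edge H i → u ≡ v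

IsStrongIndepNumber : ∀ {n} → Hypergraph n → ℕ → Set
IsStrongIndepNumber H a =
  (Σ (Subset _) λ W → StrongStable H W × ∣ W ∣ ≡ a)
  × (∀ W → StrongStable H W → ∣ W ∣ ≤ a)

IsLColouring : ∀ {n} → Hypergraph n → ℕ → ℕ → (Fin n → ℕ) → Set
IsLColouring H h k f =
  (∀ i u v → u ≢ v → u ∈ edge H i → v ∈ edge H i → h ≤ ∣ f u - f v ∣)
  × (∀ i j u v w → u ≢ v → v ∈ edge H i → u ∈ edge H j
       → w ∈ edge H i → w ∈ edge H j → w ≢ u → w ≢ v → k ≤ ∣ f u - f v ∣)

maxF : ∀ {m} → (Fin (suc m) → ℕ) → ℕ
maxF {zero}  f = f zero
maxF {suc m} f = f zero ⊔ maxF (λ i → f (suc i))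

minF : ∀ {m} → (Fin (suc m) → ℕ) → ℕ
minF {zero}  f = f zero
minF {suc m} f = f zero ⊓ minF (λ i → f (suc i))

span : ∀ {m} → (Fin (suc m) → ℕ) → ℕ
span f = maxF f ∸ minF f

-- Take a strong stable set W of maximum size a and list the vertices of W first, then the
-- others. No edge meets W twice, so colours k apart suffice on W; the remaining n - a vertices
-- get colours h apart, starting h above the last colour used on W. The span is then
-- (a - 1) k + (n - a) h = n h + a (k - h) - k.
module Submission where

open import Defs
open import Data.Nat using (ℕ; suc; _*_; _>_)
open import Data.Integer using (ℤ; +_; _+_; _-_; _≤_) renaming (_*_ to _*ℤ_)
open import Data.Product using (Σ; _×_)
open import Data.Fin using (Fin)

open import Data.Integer using (+≤+)
import Data.Integer.Properties as ℤ
open import Data.Integer.Tactic.RingSolver using (solve-∀)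
open import Data.Nat as ℕ using (zero; z≤n; s≤s; pred; _∸_; ∣_-_∣)
  renaming (_+_ to _+ℕ_; _≤_ to _≤ℕ_; _<_ to _<ℕ_)
import Data.Nat.Properties as ℕ
open import Data.Fin using () renaming (zero to fzero; suc to fsuc)
open import Data.Fin.Subset using (Subset; inside; outside; ∁; ⁅_⁆; _∉_)
  renaming (∣_∣ to ∣_∣ˢ; _∈_ to _∈ˢ_)
open import Data.Fin.Subset.Properties using (_∈?_; x∉p⇒x∈∁p; x∈⁅y⁆⇒x≡y; ∣⁅x⁆∣≡1; ∣∁p∣≡n∸∣p∣; ∣p∣≤n)
open import Data.Vec using (_∷_; here; there)
open import Data.Product using (_,_)
open import Data.Sum using (inj₁; inj₂)
open import Function using (_∘_)
open import Relation.Nullary using (¬_; yes; no; contradiction; _×-dec_)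
open import Relation.Nullary.Decidable using (toSum)
open import Relation.Binary.PropositionalEquality
  using (_≡_; _≢_; refl; sym; trans; cong; cong₂; subst; module ≡-Reasoning)

private variable
  n : ℕ

m+o≤n⇒o≤∣m-n∣ : ∀ {m n o} → m +ℕ o ≤ℕ n → o ≤ℕ ∣ m - n ∣
m+o≤n⇒o≤∣m-n∣ {m} {n} {o} m+o≤n = begin
  o             ≡⟨ ℕ.m+n∸m≡n m o ⟨
  m +ℕ o ∸ m    ≤⟨ ℕ.∸-monoˡ-≤ m m+o≤n ⟩
  n ∸ m         ≡⟨ ℕ.m≤n⇒∣m-n∣≡n∸m (ℕ.≤-trans (ℕ.m≤m+n m o) m+o≤n) ⟨
  ∣ m - n ∣     ∎
  where open ℕ.≤-Reasoning

r≢s⇒d≤∣m+r*d-m+s*d∣ : ∀ m {r s} d → r ≢ s → d ≤ℕ ∣ m +ℕ r * d - m +ℕ s * d ∣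
r≢s⇒d≤∣m+r*d-m+s*d∣ m {r} {s} d r≢s = begin
  d                          ≡⟨ ℕ.*-identityˡ d ⟨
  1 * d                      ≤⟨ ℕ.*-monoˡ-≤ d (ℕ.n≢0⇒n>0 (r≢s ∘ ℕ.∣m-n∣≡0⇒m≡n)) ⟩
  ∣ r - s ∣ * d              ≡⟨ ℕ.*-distribʳ-∣-∣ d r s ⟩
  ∣ r * d - s * d ∣          ≡⟨ ℕ.∣m+n-m+o∣≡∣n-o∣ m (r * d) (s * d) ⟨
  ∣ m +ℕ r * d - m +ℕ s * d ∣ ∎
  where
  open ℕ.≤-Reasoning

rank : Subset n → Fin n → ℕ
rank (_       ∷ p) fzero    = 0
rank (inside  ∷ p) (fsuc x) = suc (rank p x)
rank (outside ∷ p) (fsuc x) = rank p x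

rank<∣p∣ : ∀ {p : Subset n} {x} → x ∈ˢ p → rank p x <ℕ ∣ p ∣ˢ
rank<∣p∣ {p = inside  ∷ p} here        = s≤s z≤n
rank<∣p∣ {p = inside  ∷ p} (there x∈p) = s≤s (rank<∣p∣ x∈p)
rank<∣p∣ {p = outside ∷ p} (there x∈p) = rank<∣p∣ x∈p

rank-injective : ∀ {p : Subset n} {x y} → x ∈ˢ p → y ∈ˢ p → rank p x ≡ rank p y → x ≡ y
rank-injective                 here        here        _  = refl
rank-injective {p = inside  ∷ p} (there x∈p) (there y∈p) eq =
  cong fsuc (rank-injective x∈p y∈p (ℕ.suc-injective eq))
rank-injective {p = outside ∷ p} (there x∈p) (there y∈p) eq =
  cong fsuc (rank-injective x∈p y∈p eq)

module StableFirst (W : Subset n) (h k : ℕ) where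

  offset : ℕ
  offset = pred ∣ W ∣ˢ * k

  colour : Fin n → ℕ
  colour v with v ∈? W
  ... | yes _ = rank W v * k
  ... | no  _ = offset +ℕ suc (rank (∁ W) v) * h

  colour-∈ : ∀ {v} → v ∈ˢ W → colour v ≡ rank W v * k
  colour-∈ {v} v∈W with v ∈? W
  ... | yes _   = refl
  ... | no  v∉W = contradiction v∈W v∉W

  colour-∉ : ∀ {v} → v ∉ W → colour v ≡ offset +ℕ suc (rank (∁ W) v) * h
  colour-∉ {v} v∉W with v ∈? W
  ... | yes v∈W = contradiction v∈W v∉W
  ... | no  _   = refl

  rank*k≤offset : ∀ {v} → v ∈ˢ W → rank W v * k ≤ℕ offset
  rank*k≤offset v∈W = ℕ.*-monoˡ-≤ k (ℕ.suc[m]≤n⇒m≤pred[n] (rank<∣p∣ v∈W))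

  colour-≤ : ∀ v → colour v ≤ℕ offset +ℕ ∣ ∁ W ∣ˢ * h
  colour-≤ v with toSum (v ∈? W)
  ... | inj₁ v∈W rewrite colour-∈ v∈W = ℕ.≤-trans (rank*k≤offset v∈W) (ℕ.m≤m+n offset _)
  ... | inj₂ v∉W rewrite colour-∉ v∉W =
    ℕ.+-monoʳ-≤ offset (ℕ.*-monoˡ-≤ h (rank<∣p∣ (x∉p⇒x∈∁p v∉W)))

  ∈-apart : ∀ {u v} → u ∈ˢ W → v ∈ˢ W → u ≢ v → k ≤ℕ ∣ colour u - colour v ∣
  ∈-apart u∈W v∈W u≢v rewrite colour-∈ u∈W | colour-∈ v∈W =
    r≢s⇒d≤∣m+r*d-m+s*d∣ 0 k (u≢v ∘ rank-injective u∈W v∈W)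

  ∉-apart : ∀ {u v} → u ∉ W → v ∉ W → u ≢ v → h ≤ℕ ∣ colour u - colour v ∣
  ∉-apart u∉W v∉W u≢v rewrite colour-∉ u∉W | colour-∉ v∉W =
    r≢s⇒d≤∣m+r*d-m+s*d∣ offset h
      (u≢v ∘ rank-injective (x∉p⇒x∈∁p u∉W) (x∉p⇒x∈∁p v∉W) ∘ ℕ.suc-injective)

  ∈∉-apart : ∀ {u v} → u ∈ˢ W → v ∉ W → h ≤ℕ ∣ colour u - colour v ∣
  ∈∉-apart u∈W v∉W rewrite colour-∈ u∈W | colour-∉ v∉W =
    m+o≤n⇒o≤∣m-n∣ (ℕ.+-mono-≤ (rank*k≤offset u∈W) (ℕ.m≤m+n h _))

  apart : ∀ {u v} → u ≢ v → ¬ (u ∈ˢ W × v ∈ˢ W) → h ≤ℕ ∣ colour u - colour v ∣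
  apart {u} {v} u≢v ¬both with toSum (u ∈? W) | toSum (v ∈? W)
  ... | inj₁ u∈W | inj₁ v∈W = contradiction (u∈W , v∈W) ¬both
  ... | inj₁ u∈W | inj₂ v∉W = ∈∉-apart u∈W v∉W
  ... | inj₂ u∉W | inj₁ v∈W = subst (h ≤ℕ_) (ℕ.∣-∣-comm (colour v) (colour u)) (∈∉-apart v∈W u∉W)
  ... | inj₂ u∉W | inj₂ v∉W = ∉-apart u∉W v∉W u≢v

  k-apart : k ≤ℕ h → ∀ {u v} → u ≢ v → k ≤ℕ ∣ colour u - colour v ∣
  k-apart k≤h {u} {v} u≢v with u ∈? W ×-dec v ∈? W
  ... | yes (u∈W , v∈W) = ∈-apart u∈W v∈W u≢v
  ... | no  ¬both       = ℕ.≤-trans k≤h (apart u≢v ¬both)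

  isLColouring : (H : Hypergraph n) → StrongStable H W → k ≤ℕ h → IsLColouring H h k colour
  isLColouring H stable k≤h =
    (λ i u v u≢v u∈e v∈e → apart u≢v λ (u∈W , v∈W) → u≢v (stable i u v u∈W v∈W u∈e v∈e)) ,
    (λ _ _ u v _ u≢v _ _ _ _ _ _ → k-apart k≤h u≢v)

maxF≤ : ∀ {m} (f : Fin (suc m) → ℕ) {b} → (∀ i → f i ≤ℕ b) → maxF f ≤ℕ b
maxF≤ {zero}  f f≤b = f≤b fzero
maxF≤ {suc m} f f≤b = ℕ.⊔-lub (f≤b fzero) (maxF≤ (f ∘ fsuc) (f≤b ∘ fsuc))

span-formula : ∀ {a n} h k → 1 ≤ℕ a → a ≤ℕ n →
  + (pred a * k +ℕ (n ∸ a) * h) ≡ (+ (n * h) + + a *ℤ (+ k - + h)) - + k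
span-formula {suc c} {suc m} h k _ (s≤s c≤m) = begin
  + (c * k +ℕ b * h)                                    ≡⟨ ℤ.pos-+ (c * k) (b * h) ⟩
  + (c * k) + + (b * h)                                 ≡⟨ cong₂ _+_ (ℤ.pos-* c k) (ℤ.pos-* b h) ⟩
  + c *ℤ + k + + b *ℤ + h                               ≡⟨ ring (+ c) (+ b) (+ h) (+ k) ⟩
  (+ suc (c +ℕ b) *ℤ + h + + suc c *ℤ (+ k - + h)) - + k
    ≡⟨ cong (λ x → (x + _) - + k) (ℤ.pos-* (suc (c +ℕ b)) h) ⟨
  (+ (suc (c +ℕ b) * h) + + suc c *ℤ (+ k - + h)) - + k
    ≡⟨ cong (λ x → (+ (suc x * h) + + suc c *ℤ (+ k - + h)) - + k) (ℕ.m+[n∸m]≡n c≤m) ⟩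
  (+ (suc m * h) + + suc c *ℤ (+ k - + h)) - + k        ∎
  where
  open ≡-Reasoning
  b : ℕ
  b = m ∸ c
  ring : ∀ C B H K → C *ℤ K + B *ℤ H ≡ ((+ 1 + (C + B)) *ℤ H + (+ 1 + C) *ℤ (K - H)) - K
  ring = solve-∀

strongIndepNumber-positive : ∀ {m} (H : Hypergraph (suc m)) {a} → IsStrongIndepNumber H a → 1 ≤ℕ a
strongIndepNumber-positive {m} H {a} (_ , maximum) = subst (_≤ℕ a) (∣⁅x⁆∣≡1 {suc m} fzero)
  (maximum ⁅ fzero ⁆ λ _ _ _ u∈ v∈ _ _ → trans (x∈⁅y⁆⇒x≡y fzero u∈) (sym (x∈⁅y⁆⇒x≡y fzero v∈)))

mainTheorem6 : (m : ℕ) → (H : Hypergraph (suc m)) → (h k : ℕ) → h > k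
    → (a : ℕ) → IsStrongIndepNumber H a
    → Σ (Fin (suc m) → ℕ) λ f → IsLColouring H h k f
        × (+ span f ≤ (+ (suc m * h) + (+ a) *ℤ (+ k - + h)) - + k)
mainTheorem6 m H h k h>k a indep@((W , stable , ∣W∣≡a) , _) =
  colour , isLColouring H stable (ℕ.<⇒≤ h>k) ,
  subst (+ span colour ≤_) (span-formula h k (strongIndepNumber-positive H indep) a≤n)
    (+≤+ span≤)
  where
  open StableFirst W h k
  a≤n : a ≤ℕ suc m
  a≤n = subst (_≤ℕ suc m) ∣W∣≡a (∣p∣≤n W)
  span≤ : span colour ≤ℕ pred a * k +ℕ (suc m ∸ a) * h
  span≤ = begin
    span colour                               ≤⟨ ℕ.m∸n≤m (maxF colour) (minF colour) ⟩
    maxF colour                               ≤⟨ maxF≤ colour colour-≤ ⟩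
    offset +ℕ ∣ ∁ W ∣ˢ * h                    ≡⟨ cong (λ c → offset +ℕ c * h) (∣∁p∣≡n∸∣p∣ W) ⟩
    pred ∣ W ∣ˢ * k +ℕ (suc m ∸ ∣ W ∣ˢ) * h  ≡⟨ cong (λ w → pred w * k +ℕ (suc m ∸ w) * h) ∣W∣≡a ⟩
    pred a * k +ℕ (suc m ∸ a) * h             ∎
    where open ℕ.≤-Reasoning
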